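{- Let $r\ge 2$, $p\ge 2$ and $k\ge p$ be integers. For any $k$-uniform hypergraph $G=(V,E)$, $$\chi^c(G,k,r,p)\ \ge\ \log_r \chi(G,p).$$
   Context: For a $k$-uniform hypergraph $G=(V,E)$, an $r$-coloring is a map $V\to\{1,\dots,r\}$. A hyperedge $e$ is properly $(r,p)$ colored by an $r$-coloring if $e$ contains at least $\min(p,|e|)$ vertices of pairwise distinct colors. A strong $(r,p)$ cover of $G$ is a set of $r$-colorings of $V$ such that every hyperedge is properly $(r,p)$ colored by at least one of them; $\chi^c(G,k,r,p)$ is the minimum cardinality of such a cover. The $p$-strong chromatic number $\chi(G,p)$ is the minimum number of colors in an assignment of colors to the vertices of $V$ such that every hyperedge $e\in E$ contains $\min\{p,|e|\}$ vertices of pairwise distinct colors. -}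

module Defs where

open import Data.Nat using (ℕ; _≥_; _⊓_)
open import Data.Fin using (Fin)
open import Data.Fin.Subset using (Subset; _∈_; _⊆_; ∣_∣)
open import Data.List using (List)
open import Data.List.Relation.Unary.All using (All)
open import Data.List.Relation.Unary.Any using (Any)
open import Data.Product using (∃; _×_)
open import Relation.Binary.PropositionalEquality using (_≡_)

record Hypergraph (n : ℕ) : Set where
  constructor hypergraph
  field
    edges : List (Subset n)

open Hypergraph public

Uniform : ∀ {n} → ℕ → Hypergraph n → Set
Uniform k G = All (λ e → ∣ e ∣ ≡ k) (edges G)

ProperlyColored : ∀ {n m} → (Fin n → Fin m) → ℕ → Subset n → Set
ProperlyColored {n} f p e =
  ∃ λ (S : Subset n) → S ⊆ e × ∣ S ∣ ≥ p ⊓ ∣ e ∣ ×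
    (∀ {x y} → x ∈ S → y ∈ S → f x ≡ f y → x ≡ y)

-- A strong (r,p) cover: a collection of r-colorings such that every hyperedge is
-- properly (r,p) colored by at least one of them. Its cardinality is its length.
StrongCover : ∀ {n} (r p : ℕ) → Hypergraph n → List (Fin n → Fin r) → Set
StrongCover r p G C = All (λ e → Any (λ f → ProperlyColored f p e) C) (edges G)

PStrongColoring : ∀ {n} (m p : ℕ) → Hypergraph n → (Fin n → Fin m) → Set
PStrongColoring m p G f = All (ProperlyColored f p) (edges G)

module Submission where

-- Given a strong (r,p) cover C = c₁,…,c_t, colour each vertex x by the tuple
-- (c₁ x, …, c_t x), encoded as a single element of Fin (r ^ t).  This product
-- colouring separates any two vertices separated by some cᵢ.  A hyperedge e is
-- properly coloured by some cᵢ, i.e. it contains a set S of min(p,|e|) vertices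
-- on which cᵢ is injective; the product colouring is then injective on S too.
-- Hence the product colouring is a p-strong colouring with r ^ t colours, which
-- is the statement χ(G,p) ≤ r ^ χ^c(G,k,r,p), i.e. χ^c ≥ log_r χ(G,p).

open import Defs
open import Data.Nat using (ℕ; _≤_; _^_)
open import Data.Fin using (Fin; zero; combine)
open import Data.Fin.Properties using (combine-injectiveˡ; combine-injectiveʳ)
open import Data.List using (List; length; []; _∷_)
import Data.List.Relation.Unary.All as All
open import Data.List.Relation.Unary.Any using (Any; here; there)
open import Data.Product using (∃; _,_)
open import Relation.Binary.PropositionalEquality using (_≡_)

Refines : ∀ {n a b} → (Fin n → Fin b) → (Fin n → Fin a) → Set
Refines {n} g f = ∀ (x y : Fin n) → g x ≡ g y → f x ≡ f y

properly-colored-refine : ∀ {n a b p e} {f : Fin n → Fin a} {g : Fin n → Fin b} →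
  Refines g f → ProperlyColored f p e → ProperlyColored g p e
properly-colored-refine g⊑f (S , S⊆e , size , rainbow) =
  S , S⊆e , size , λ {x} {y} x∈S y∈S gx≡gy → rainbow x∈S y∈S (g⊑f x y gx≡gy)

product-coloring : ∀ {n r} (C : List (Fin n → Fin r)) → Fin n → Fin (r ^ length C)
product-coloring []      x = zero
product-coloring (c ∷ C) x = combine (c x) (product-coloring C x)

-- Since `combine` is injective, the product colouring refines every member of C,
-- so it properly colours every edge that some member of C properly colours.
product-coloring-proper : ∀ {n r p e} (C : List (Fin n → Fin r)) →
  Any (λ c → ProperlyColored c p e) C → ProperlyColored (product-coloring C) p e
product-coloring-proper (c ∷ C) (here proper) =
  properly-colored-refine
    (λ x y → combine-injectiveˡ (c x) (product-coloring C x) (c y) (product-coloring C y))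
    proper
product-coloring-proper (c ∷ C) (there proper) =
  properly-colored-refine
    (λ x y → combine-injectiveʳ (c x) (product-coloring C x) (c y) (product-coloring C y))
    (product-coloring-proper C proper)

mainTheorem7 : (r p k n : ℕ) → 2 ≤ r → 2 ≤ p → p ≤ k →
    (G : Hypergraph n) → Uniform k G →
    (C : List (Fin n → Fin r)) → StrongCover r p G C →
    ∃ λ (f : Fin n → Fin (r ^ length C)) → PStrongColoring (r ^ length C) p G f
mainTheorem7 r p k n _ _ _ G _ C cover =
  product-coloring C , All.map (product-coloring-proper C) cover
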